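{- Let $H=(X\cup Y,E)$ be a $3$-regular bipartite graph with $|X|=|Y|=n$, and fix a bijection $\mathrm{order}:Y\to\{1,\dots,n\}$. Construct the rank-maximal matchings instance $G$ with applicants $\{a_x:x\in X\}\cup\{ad_1,\dots,ad_{n-3}\}$ and posts $\{p_y:y\in Y\}\cup\{pd_1,\dots,pd_{n-3}\}$, where each dummy applicant $ad_i$ has the single post $pd_i$ as its rank-$1$ post, and each applicant $a_x$ ranks $p_{y_1},p_{y_2},p_{y_3}$ at ranks $\mathrm{order}(y_1),\mathrm{order}(y_2),\mathrm{order}(y_3)$ respectively, where $y_1,y_2,y_3$ are the three neighbours of $x$ in $H$, the remaining $n-3$ ranks $1,\dots,n$ in the list of $a_x$ being filled by the $n-3$ dummy posts $pd_1,\dots,pd_{n-3}$ (each used once). Then there is a one-to-one correspondence between the perfect matchings of $H$ and the rank-maximal matchings of $G$.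
   Context: In an instance of the rank-maximal matchings problem, each applicant ranks a set of posts (rank $i$ = $i$-th choice) and edges join applicants to the posts they rank. The signature of a matching $M$ is $(x_1,\dots,x_r)$ with $x_i$ the number of applicants matched to a post of rank $i$ ($r$ the maximum rank); signatures are compared lexicographically (larger is better) and a matching is rank-maximal if its signature is maximum. -}

module Defs where

open import Data.Nat using (ℕ; zero; suc; _+_; _∸_; _≤_; _<_)
open import Data.Nat.Properties using () renaming (_≟_ to _≟ℕ_)
open import Data.Fin using (Fin; toℕ; splitAt) renaming (zero to fzero; suc to fsuc)
open import Data.Fin.Properties using () renaming (_≟_ to _≟F_)
open import Data.Bool using (Bool; true; false; if_then_else_)
open import Data.Maybe using (Maybe; just; nothing; _>>=_)
open import Data.Maybe.Properties using (≡-dec)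
open import Data.Sum using (_⊎_; inj₁; inj₂)
open import Data.Product using (Σ; ∃; _×_; _,_; proj₁)
open import Relation.Nullary using (¬_; Dec; yes; no)
open import Relation.Binary.PropositionalEquality using (_≡_; _≢_)

count : ∀ {k} → (Fin k → Bool) → ℕ
count {zero}  f = 0
count {suc k} f = (if f fzero then 1 else 0) + count (λ i → f (fsuc i))

decToBool : ∀ {a} {A : Set a} → Dec A → Bool
decToBool (yes _) = true
decToBool (no _)  = false

-- An instance: applicants Fin na, posts Fin np, maximum rank r.
-- rank a p = just i  means applicant a ranks post p at rank i (i ≥ 1);
-- rank a p = nothing means there is no edge between a and p.
record Instance : Set where
  field
    na np r : ℕ
    rank    : Fin na → Fin np → Maybe ℕ
open Instance public

IsMatching : (I : Instance) → (Fin (na I) → Maybe (Fin (np I))) → Set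
IsMatching I M =
  (∀ a p → M a ≡ just p → rank I a p ≢ nothing) ×
  (∀ a a' p → M a ≡ just p → M a' ≡ just p → a ≡ a')

Matching : Instance → Set
Matching I = Σ (Fin (na I) → Maybe (Fin (np I))) (IsMatching I)

matchedRank : (I : Instance) → (Fin (na I) → Maybe (Fin (np I))) → Fin (na I) → Maybe ℕ
matchedRank I M a = M a >>= rank I a

signature : (I : Instance) → Matching I → ℕ → ℕ
signature I (M , _) i = count (λ a → decToBool (≡-dec _≟ℕ_ (matchedRank I M a) (just i)))

LexGreater : ℕ → (ℕ → ℕ) → (ℕ → ℕ) → Set
LexGreater r s' s = ∃ λ i → (1 ≤ i) × (i ≤ r) ×
  (∀ j → 1 ≤ j → j < i → s' j ≡ s j) × (s i < s' i)

RankMaximal : (I : Instance) → Matching I → Set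
RankMaximal I M = ∀ (M' : Matching I) → ¬ LexGreater (r I) (signature I M') (signature I M)

RankMaximalMatching : Instance → Set
RankMaximalMatching I = Σ (Matching I) (RankMaximal I)

ThreeRegular : (n : ℕ) → (Fin n → Fin n → Bool) → Set
ThreeRegular n E = (∀ x → count (λ y → E x y) ≡ 3) × (∀ y → count (λ x → E x y) ≡ 3)

IsPerfectMatching : (n : ℕ) → (Fin n → Fin n → Bool) → (Fin n → Fin n) → Set
IsPerfectMatching n E μ =
  (∀ x → E x (μ x) ≡ true) ×
  (∀ x x' → μ x ≡ μ x' → x ≡ x') ×
  (∀ y → ∃ λ x → μ x ≡ y)

PerfectMatching : (n : ℕ) → (Fin n → Fin n → Bool) → Set
PerfectMatching n E = Σ (Fin n → Fin n) (IsPerfectMatching n E)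

IsBijection : ∀ {n} → (Fin n → Fin n) → Set
IsBijection {n} f = (∀ a b → f a ≡ f b → a ≡ b) × (∀ y → ∃ λ x → f x ≡ y)

-- Ranks are encoded 0-based in Fin n: k : Fin n stands
-- for rank toℕ k + 1.
--   order : Y → Fin n   (bijection Y → {1,…,n})
--   dummyRank x i : the rank (0-based) at which applicant a_x lists pd_i.

ValidFilling : (n : ℕ) → (Fin n → Fin n → Bool) → (Fin n → Fin n) →
               (Fin n → Fin (n ∸ 3) → Fin n) → Set
ValidFilling n E order dummyRank = ∀ x →
  (∀ i j → dummyRank x i ≡ dummyRank x j → i ≡ j) ×
  (∀ k → ((∃ λ i → dummyRank x i ≡ k) → ¬ (∃ λ y → (E x y ≡ true) × (order y ≡ k))) ×
         (¬ (∃ λ y → (E x y ≡ true) × (order y ≡ k)) → ∃ λ i → dummyRank x i ≡ k))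

-- Applicants: Fin (n + (n ∸ 3)) = a_x (x : Fin n) then ad_i (i : Fin (n ∸ 3)).
-- Posts:      Fin (n + (n ∸ 3)) = p_y (y : Fin n) then pd_i (i : Fin (n ∸ 3)).
rankG : (n : ℕ) → (Fin n → Fin n → Bool) → (Fin n → Fin n) →
        (Fin n → Fin (n ∸ 3) → Fin n) →
        Fin (n + (n ∸ 3)) → Fin (n + (n ∸ 3)) → Maybe ℕ
rankG n E order dummyRank a p with splitAt n a | splitAt n p
... | inj₁ x | inj₁ y = if E x y then just (suc (toℕ (order y))) else nothing
... | inj₁ x | inj₂ i = just (suc (toℕ (dummyRank x i)))
... | inj₂ i | inj₁ y = nothing
... | inj₂ i | inj₂ j = if decToBool (i ≟F j) then just 1 else nothing

instanceG : (n : ℕ) → (Fin n → Fin n → Bool) → (Fin n → Fin n) →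
            (Fin n → Fin (n ∸ 3) → Fin n) → Instance
instanceG n E order dummyRank = record
  { na = n + (n ∸ 3) ; np = n + (n ∸ 3) ; r = n
  ; rank = rankG n E order dummyRank }

module Submission where

-- A perfect matching μ of H yields the matching a_x ↦ p_(μ x), ad_i ↦ pd_i of G, whose
-- signature is (n − 2, 1, …, 1): every p_y is taken at rank order(y) and every dummy post at
-- rank 1.  Nothing beats it, because each rank belongs to a single real post: at most
-- 1 + (n − 3) applicants get rank 1, and when that many do, all dummy posts are used up at
-- rank 1, so every later rank is attained at most once.  A rank-maximal matching therefore has
-- exactly this signature; then every p_y is taken, necessarily by some a_x, so the a_x are
-- matched onto the p_y (a perfect matching of H) and each pd_i is left to ad_i.  The
-- prescribed ranks of the dummy posts play no role.  The comparison needs some perfect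
-- matching of H; one exists by Hall's theorem, since a 3-regular bipartite graph satisfies
-- Hall's condition by double counting, and augmenting along alternating paths then matches
-- every vertex.

open import Defs
open import Data.Bool using (Bool; true; false; if_then_else_)
open import Data.Bool.Properties using (¬-not) renaming (_≟_ to _≟B_)
open import Data.Fin using (Fin; toℕ; fromℕ<; splitAt; _↑ˡ_; _↑ʳ_; punchOut)
  renaming (zero to fzero; suc to fsuc)
open import Data.Fin.Properties
  using (any?; ¬∀⟶∃¬; punchOut-injective; injective⇒≤; toℕ-injective; toℕ-fromℕ<; toℕ<n; ↑ˡ-injective;
         splitAt-↑ˡ; splitAt-↑ʳ; splitAt⁻¹-↑ˡ; splitAt⁻¹-↑ʳ)
  renaming (_≟_ to _≟F_; suc-injective to fsuc-injective)
open import Data.Maybe using (Maybe; just; nothing)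
open import Data.Maybe.Properties using (just-injective; ≡-dec)
open import Data.Nat using (ℕ; zero; suc; _+_; _*_; _∸_; _≤_; _<_; z≤n; s≤s; NonZero)
open import Data.Nat.Induction using (<-rec)
open import Data.Nat.Properties
open import Algebra.Properties.Semiring.Sum +-*-semiring using (sum; sum-cong-≗; ∑-comm; *-distribˡ-sum)
open import Data.Product using (Σ; ∃; _×_; _,_; proj₁; proj₂)
open import Data.Sum using (_⊎_; inj₁; inj₂; [_,_]′)
open import Data.Vec.Functional using (updateAt)
open import Data.Vec.Functional.Properties using (updateAt-updates; updateAt-minimal)
open import Function using (_∘_; const)
open import Relation.Nullary using (¬_; Dec; yes; no; contradiction)
open import Relation.Nullary.Decidable using (_×-dec_; _⊎-dec_; ¬?; _→-dec_)
open import Relation.Binary.PropositionalEquality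

decToBool-sound : ∀ {a} {A : Set a} (d : Dec A) → decToBool d ≡ true → A
decToBool-sound (yes a) _ = a

decToBool-complete : ∀ {a} {A : Set a} (d : Dec A) → A → decToBool d ≡ true
decToBool-complete (yes _) _ = refl
decToBool-complete (no ¬a) a = contradiction a ¬a

decToBool-reject : ∀ {a} {A : Set a} (d : Dec A) → ¬ A → decToBool d ≡ false
decToBool-reject (yes a) ¬a = contradiction a ¬a
decToBool-reject (no _)  _  = refl

𝟙 : Bool → ℕ
𝟙 b = if b then 1 else 0

count≡sum : ∀ {k} (f : Fin k → Bool) → count f ≡ sum (𝟙 ∘ f)
count≡sum {zero}  f = refl
count≡sum {suc k} f = cong (𝟙 (f fzero) +_) (count≡sum (f ∘ fsuc))

sum-mono-≤ : ∀ {k} {f g : Fin k → ℕ} → (∀ i → f i ≤ g i) → sum f ≤ sum g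
sum-mono-≤ {zero}  _   = z≤n
sum-mono-≤ {suc k} f≤g = +-mono-≤ (f≤g fzero) (sum-mono-≤ (f≤g ∘ fsuc))

𝟙-mono : ∀ {a b} → (a ≡ true → b ≡ true) → 𝟙 a ≤ 𝟙 b
𝟙-mono {false} _   = z≤n
𝟙-mono {true}  a⇒b rewrite a⇒b refl = ≤-refl

count-mono : ∀ {k} {f g : Fin k → Bool} → (∀ i → f i ≡ true → g i ≡ true) → count f ≤ count g
count-mono {zero}  _   = z≤n
count-mono {suc k} f⊆g = +-mono-≤ (𝟙-mono (f⊆g fzero)) (count-mono (f⊆g ∘ fsuc))

count-≤ : ∀ {k} (f : Fin k → Bool) → count f ≤ k
count-≤ {zero}  f = z≤n
count-≤ {suc k} f = +-mono-≤ (𝟙≤1 (f fzero)) (count-≤ (f ∘ fsuc))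
  where
  𝟙≤1 : ∀ b → 𝟙 b ≤ 1
  𝟙≤1 false = z≤n
  𝟙≤1 true  = ≤-refl

count-zero : ∀ {k} (f : Fin k → Bool) → (∀ i → f i ≡ false) → count f ≡ 0
count-zero {zero}  f _     = refl
count-zero {suc k} f none rewrite none fzero = count-zero (f ∘ fsuc) (none ∘ fsuc)

count-all : ∀ {k} (f : Fin k → Bool) → (∀ i → f i ≡ true) → count f ≡ k
count-all {zero}  f _   = refl
count-all {suc k} f all rewrite all fzero = cong suc (count-all (f ∘ fsuc) (all ∘ fsuc))

count-< : ∀ {k} {f g : Fin k → Bool} → (∀ i → f i ≡ true → g i ≡ true) →
          ∀ i → f i ≡ false → g i ≡ true → count f < count g
count-< {f = f} {g} f⊆g fzero fi gi rewrite fi | gi = s≤s (count-mono (f⊆g ∘ fsuc))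
count-< f⊆g (fsuc i) fi gi = +-mono-≤-< (𝟙-mono (f⊆g fzero)) (count-< (f⊆g ∘ fsuc) i fi gi)

count-full : ∀ {k} (f : Fin k → Bool) → count f ≡ k → ∀ i → f i ≡ true
count-full f full i with f i in fi
... | true  = refl
... | false = contradiction (trans full (sym (count-all (const true) λ _ → refl)))
                            (<⇒≢ (count-< (λ _ _ → refl) i fi refl))

count-pos : ∀ {k} (f : Fin k → Bool) → 0 < count f → ∃ λ i → f i ≡ true
count-pos {suc k} f pos with f fzero in f0
... | true  = fzero , f0
... | false = let i , fi = count-pos (f ∘ fsuc) pos in fsuc i , fi

1≤count : ∀ {k} (f : Fin k → Bool) → ∀ i → f i ≡ true → 1 ≤ count f
1≤count {k} f i fi = subst (_< count f) (count-zero {k} (const false) λ _ → refl) (count-< (λ _ ()) i refl fi)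

count≤1 : ∀ {k} (f : Fin k → Bool) → (∀ i j → f i ≡ true → f j ≡ true → i ≡ j) → count f ≤ 1
count≤1 {zero}  f _      = z≤n
count≤1 {suc k} f unique with f fzero in f0
... | true  = ≤-reflexive (cong suc (count-zero (f ∘ fsuc) rest-false))
  where
  rest-false : ∀ i → f (fsuc i) ≡ false
  rest-false i with f (fsuc i) in fi
  ... | true  = contradiction (unique fzero (fsuc i) f0 fi) λ ()
  ... | false = refl
... | false = count≤1 (f ∘ fsuc) λ i j fi fj → fsuc-injective (unique (fsuc i) (fsuc j) fi fj)

count≡1 : ∀ {k} (f : Fin k → Bool) → ∀ i → f i ≡ true → (∀ i j → f i ≡ true → f j ≡ true → i ≡ j) →
          count f ≡ 1
count≡1 f i fi unique = ≤-antisym (count≤1 f unique) (1≤count f i fi)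

count-split : ∀ {n m} (f : Fin (n + m) → Bool) →
              count f ≡ count (λ i → f (i ↑ˡ m)) + count (λ j → f (n ↑ʳ j))
count-split {zero}  f = refl
count-split {suc n} f = trans (cong (𝟙 (f fzero) +_) (count-split {n} (f ∘ fsuc))) (sym (+-assoc (𝟙 (f fzero)) _ _))

double-count : ∀ {k l} d (P : Fin k → Bool) (Q : Fin l → Bool) (w : Fin k → Fin l → Bool) →
               (∀ p → P p ≡ true → d ≤ count (w p)) →
               (∀ q → count (λ p → w p q) ≤ d) →
               (∀ p q → w p q ≡ true → Q q ≡ true) →
               d * count P ≤ d * count Q
double-count d P Q w rows columns w⊆Q = begin
  d * count P                            ≡⟨ cong (d *_) (count≡sum P) ⟩
  d * sum (𝟙 ∘ P)                        ≡⟨ *-distribˡ-sum d (𝟙 ∘ P) ⟩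
  sum (λ p → d * 𝟙 (P p))                ≤⟨ sum-mono-≤ row-bound ⟩
  sum (λ p → count (w p))                ≡⟨ sum-cong-≗ (count≡sum ∘ w) ⟩
  sum (λ p → sum (λ q → 𝟙 (w p q)))      ≡⟨ ∑-comm (λ p q → 𝟙 (w p q)) ⟩
  sum (λ q → sum (λ p → 𝟙 (w p q)))      ≡⟨ sum-cong-≗ (λ q → count≡sum (λ p → w p q)) ⟨
  sum (λ q → count (λ p → w p q))        ≤⟨ sum-mono-≤ column-bound ⟩
  sum (λ q → d * 𝟙 (Q q))                ≡⟨ *-distribˡ-sum d (𝟙 ∘ Q) ⟨
  d * sum (𝟙 ∘ Q)                        ≡⟨ cong (d *_) (count≡sum Q) ⟨
  d * count Q                            ∎
  where
  open ≤-Reasoning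
  row-bound : ∀ p → d * 𝟙 (P p) ≤ count (w p)
  row-bound p with P p in Pp
  ... | true  = subst (_≤ count (w p)) (sym (*-identityʳ d)) (rows p Pp)
  ... | false = subst (_≤ count (w p)) (sym (*-zeroʳ d)) z≤n
  column-bound : ∀ q → count (λ p → w p q) ≤ d * 𝟙 (Q q)
  column-bound q with Q q in Qq
  ... | true  = subst (count (λ p → w p q) ≤_) (sym (*-identityʳ d)) (columns q)
  ... | false = ≤-reflexive (trans (count-zero (λ p → w p q) outside) (sym (*-zeroʳ d)))
    where
    outside : ∀ p → w p q ≡ false
    outside p with w p q in wpq
    ... | true  = contradiction (trans (sym (w⊆Q p q wpq)) Qq) λ ()
    ... | false = refl

injection⇒count-≤ : ∀ {k l ℓ} (P : Fin k → Bool) (Q : Fin l → Bool)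
                    (ρ : Fin k → Fin l → Set ℓ) → (∀ p q → Dec (ρ p q)) →
                    (∀ p → P p ≡ true → ∃ λ q → Q q ≡ true × ρ p q) →
                    (∀ p p′ q → P p ≡ true → P p′ ≡ true → ρ p q → ρ p′ q → p ≡ p′) →
                    count P ≤ count Q
injection⇒count-≤ P Q ρ ρ? total unique =
  *-cancelˡ-≤ 1 (double-count 1 P Q w rows columns λ p q → proj₁ ∘ proj₂ ∘ decToBool-sound (edge? p q))
  where
  edge? : ∀ p q → Dec (P p ≡ true × Q q ≡ true × ρ p q)
  edge? p q = (P p ≟B true) ×-dec (Q q ≟B true) ×-dec ρ? p q
  w : _ → _ → Bool
  w p q = decToBool (edge? p q)
  rows : ∀ p → P p ≡ true → 1 ≤ count (w p)
  rows p Pp = let q , Qq , ρpq = total p Pp in 1≤count (w p) q (decToBool-complete (edge? p q) (Pp , Qq , ρpq))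
  columns : ∀ q → count (λ p → w p q) ≤ 1
  columns q = count≤1 (λ p → w p q) λ p p′ wpq wp′q →
    let Pp  , _ , ρpq  = decToBool-sound (edge? p q) wpq
        Pp′ , _ , ρp′q = decToBool-sound (edge? p′ q) wp′q
    in unique p p′ q Pp Pp′ ρpq ρp′q

injective⇒surjective : ∀ {k} (f : Fin k → Fin k) → (∀ a b → f a ≡ f b → a ≡ b) →
                       ∀ y → ∃ λ x → f x ≡ y
injective⇒surjective {suc k} f injective y with any? (λ x → f x ≟F y)
... | yes hit  = hit
... | no  miss = contradiction (injective⇒≤ punched-injective) (<-irrefl refl)
  where
  punched : Fin (suc k) → Fin k
  punched x = punchOut {i = y} {j = f x} λ y≡fx → miss (x , sym y≡fx)
  punched-injective : ∀ {a b} → punched a ≡ punched b → a ≡ b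
  punched-injective {a} {b} = injective a b ∘ punchOut-injective {i = y} _ _

Dominates : ℕ → (ℕ → ℕ) → (ℕ → ℕ) → Set
Dominates r s t = ∀ i → 1 ≤ i → i ≤ r → (∀ j → 1 ≤ j → j < i → t j ≡ s j) → t i ≤ s i

dominates⇒¬lexGreater : ∀ {r s t} → Dominates r s t → ¬ LexGreater r t s
dominates⇒¬lexGreater dominates (i , 1≤i , i≤r , agree , s<t) = <⇒≱ s<t (dominates i 1≤i i≤r agree)

dominates⇒agree : ∀ {r s t} → Dominates r s t → ¬ LexGreater r s t →
                  ∀ i → 1 ≤ i → i ≤ r → t i ≡ s i
dominates⇒agree {r} {s} {t} dominates maximal = <-rec _ agree-at
  where
  agree-at : ∀ i → (∀ {j} → j < i → 1 ≤ j → j ≤ r → t j ≡ s j) → 1 ≤ i → i ≤ r → t i ≡ s i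
  agree-at i below 1≤i i≤r = ≤-antisym (dominates i 1≤i i≤r agree)
    (≮⇒≥ λ t<s → maximal (i , 1≤i , i≤r , (λ j 1≤j j<i → sym (agree j 1≤j j<i)) , t<s))
    where
    agree : ∀ j → 1 ≤ j → j < i → t j ≡ s j
    agree j 1≤j j<i = below j<i 1≤j (≤-trans (<⇒≤ j<i) i≤r)

module Hall (n : ℕ) (E : Fin n → Fin n → Bool) where

  PartialMatching : Set
  PartialMatching = Fin n → Maybe (Fin n)

  Matched : PartialMatching → Fin n → Set
  Matched ν x = ∃ λ y → ν x ≡ just y

  IsValid : PartialMatching → Set
  IsValid ν = (∀ x y → ν x ≡ just y → E x y ≡ true) ×
              (∀ x x′ y → ν x ≡ just y → ν x′ ≡ just y → x ≡ x′)

  neighbours : (Fin n → Bool) → Fin n → Bool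
  neighbours R y = decToBool (any? λ x → (R x ≟B true) ×-dec (E x y ≟B true))

  neighbours-sound : ∀ {R y} → neighbours R y ≡ true → ∃ λ x → R x ≡ true × E x y ≡ true
  neighbours-sound = decToBool-sound (any? _)

  HallCondition : Set
  HallCondition = ∀ R → count R ≤ count (neighbours R)

  regular⇒hall : ∀ d .{{_ : NonZero d}} →
                 (∀ x → count (λ y → E x y) ≡ d) → (∀ y → count (λ x → E x y) ≡ d) → HallCondition
  regular⇒hall d degX degY R = *-cancelˡ-≤ d (double-count d R (neighbours R) w rows columns w⊆N)
    where
    edge? : ∀ x y → Dec (R x ≡ true × E x y ≡ true)
    edge? x y = (R x ≟B true) ×-dec (E x y ≟B true)
    w : Fin n → Fin n → Bool
    w x y = decToBool (edge? x y)
    rows : ∀ x → R x ≡ true → d ≤ count (w x)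
    rows x Rx = subst (_≤ count (w x)) (degX x) (count-mono λ y Exy → decToBool-complete (edge? x y) (Rx , Exy))
    columns : ∀ y → count (λ x → w x y) ≤ d
    columns y = subst (count (λ x → w x y) ≤_) (degY y)
                      (count-mono λ x wxy → proj₂ (decToBool-sound (edge? x y) wxy))
    w⊆N : ∀ x y → w x y ≡ true → neighbours R y ≡ true
    w⊆N x y wxy = decToBool-complete (any? _) (x , decToBool-sound (edge? x y) wxy)

  _[_≔_] : PartialMatching → Fin n → Maybe (Fin n) → PartialMatching
  ν [ x ≔ v ] = updateAt ν x (const v)

  ≔-here : ∀ ν x v → (ν [ x ≔ v ]) x ≡ v
  ≔-here ν x v = updateAt-updates x ν

  ≔-there : ∀ ν x v {z} → z ≢ x → (ν [ x ≔ v ]) z ≡ ν z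
  ≔-there ν x v {z} z≢x = updateAt-minimal z x ν z≢x

  ≔-just : ∀ ν x v {z w} → (ν [ x ≔ v ]) z ≡ just w →
           (z ≡ x × v ≡ just w) ⊎ (z ≢ x × ν z ≡ just w)
  ≔-just ν x v {z} e with z ≟F x
  ... | yes refl = inj₁ (refl , trans (sym (≔-here ν x v)) e)
  ... | no z≢x   = inj₂ (z≢x , trans (sym (≔-there ν x v z≢x)) e)

  Augmentation : PartialMatching → Fin n → Set
  Augmentation ν u =
    Σ PartialMatching λ ν′ → IsValid ν′ × Matched ν′ u × (∀ z → Matched ν z → Matched ν′ z)

  unassign-valid : ∀ {ν} x → IsValid ν → IsValid (ν [ x ≔ nothing ])
  unassign-valid {ν} x (edges , injective) =
    (λ z w → edges z w ∘ before) , (λ z z′ w e e′ → injective z z′ w (before e) (before e′))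
    where
    before : ∀ {z w} → (ν [ x ≔ nothing ]) z ≡ just w → ν z ≡ just w
    before e with ≔-just ν x nothing e
    ... | inj₂ (_ , νz) = νz

  assign-valid : ∀ {ν x y} → IsValid ν → E x y ≡ true → (∀ z → ν z ≢ just y) →
                 IsValid (ν [ x ≔ just y ])
  assign-valid {ν} {x} {y} (edges , injective) Exy unused = edges′ , injective′
    where
    edges′ : ∀ z w → (ν [ x ≔ just y ]) z ≡ just w → E z w ≡ true
    edges′ z w e with ≔-just ν x (just y) e
    ... | inj₁ (refl , refl) = Exy
    ... | inj₂ (_ , νz)      = edges z w νz
    injective′ : ∀ z z′ w → (ν [ x ≔ just y ]) z ≡ just w → (ν [ x ≔ just y ]) z′ ≡ just w → z ≡ z′
    injective′ z z′ w e e′ with ≔-just ν x (just y) e | ≔-just ν x (just y) e′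
    ... | inj₁ (z≡x , _)    | inj₁ (z′≡x , _)   = trans z≡x (sym z′≡x)
    ... | inj₁ (_ , refl)   | inj₂ (_ , νz′)    = contradiction νz′ (unused z′)
    ... | inj₂ (_ , νz)     | inj₁ (_ , refl)   = contradiction νz (unused z)
    ... | inj₂ (_ , νz)     | inj₂ (_ , νz′)    = injective z z′ w νz νz′

  module AlternatingPaths (hall : HallCondition) (μ : PartialMatching) (μ-valid : IsValid μ)
                          (u : Fin n) (u-free : μ u ≡ nothing) where

    -- ν arises from μ by flipping an alternating path that runs from u to x inside R.
    record Freeing (R : Fin n → Bool) (x : Fin n) : Set where
      field
        ν       : PartialMatching
        valid   : IsValid ν
        frees   : ν x ≡ nothing
        keeps   : ∀ z → z ≢ x → Matched μ z ⊎ z ≡ u → Matched ν z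
        outside : ∀ z → R z ≢ true → ν z ≡ μ z
        image   : ∀ z w → ν z ≡ just w → ∃ λ z′ → μ z′ ≡ just w

    Explored : (Fin n → Bool) → Set
    Explored R = R u ≡ true × (∀ x → R x ≡ true → Freeing R x)

    ⁅_⁆ : Fin n → Fin n → Bool
    ⁅ x ⁆ z = decToBool (z ≟F x)

    insert : Fin n → (Fin n → Bool) → Fin n → Bool
    insert x R z = decToBool ((R z ≟B true) ⊎-dec (z ≟F x))

    without : Fin n → (Fin n → Bool) → Fin n → Bool
    without x R z = decToBool ((R z ≟B true) ×-dec ¬? (z ≟F x))

    freeing-mono : ∀ {R R′ x} → (∀ z → R z ≡ true → R′ z ≡ true) → Freeing R x → Freeing R′ x
    freeing-mono R⊆R′ F = record
      { ν = ν ; valid = valid ; frees = frees ; keeps = keeps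
      ; outside = λ z z∉R′ → outside z (z∉R′ ∘ R⊆R′ z) ; image = image }
      where open Freeing F

    explored-start : Explored ⁅ u ⁆
    explored-start = decToBool-complete (u ≟F u) refl , freeing-u
      where
      freeing-u : ∀ x → ⁅ u ⁆ x ≡ true → Freeing ⁅ u ⁆ x
      freeing-u x x≡u with decToBool-sound (x ≟F u) x≡u
      ... | refl = record
        { ν = μ ; valid = μ-valid ; frees = u-free
        ; keeps = λ { z _ (inj₁ matched) → matched ; z z≢u (inj₂ z≡u) → contradiction z≡u z≢u }
        ; outside = λ _ _ → refl ; image = λ z _ μz → z , μz }

    alternate : ∀ {R x x″ y} → R x ≡ true → Freeing R x → E x y ≡ true → μ x″ ≡ just y → R x″ ≢ true →
                Freeing (insert x″ R) x″
    alternate {R} {x} {x″} {y} Rx F Exy μx″ x″∉R = record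
      { ν = ν′
      ; valid = assign-valid (unassign-valid x″ F.valid) Exy y-unused
      ; frees = trans (≔-there _ x _ x″≢x) (≔-here F.ν x″ nothing)
      ; keeps = keeps′ ; outside = outside′ ; image = image′ }
      where
      module F = Freeing F
      ν′ : PartialMatching
      ν′ = (F.ν [ x″ ≔ nothing ]) [ x ≔ just y ]
      x″≢x : x″ ≢ x
      x″≢x refl = x″∉R Rx
      y-unused : ∀ z → (F.ν [ x″ ≔ nothing ]) z ≢ just y
      y-unused z e with ≔-just F.ν x″ nothing e
      ... | inj₂ (z≢x″ , νz) = z≢x″ (proj₂ F.valid z x″ y νz (trans (F.outside x″ x″∉R) μx″))
      keeps′ : ∀ z → z ≢ x″ → Matched μ z ⊎ z ≡ u → Matched ν′ z
      keeps′ z z≢x″ covered with z ≟F x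
      ... | yes refl = y , ≔-here _ x _
      ... | no z≢x   = let w , νz = F.keeps z z≢x covered
                       in w , trans (≔-there _ x _ z≢x) (trans (≔-there F.ν x″ _ z≢x″) νz)
      outside′ : ∀ z → insert x″ R z ≢ true → ν′ z ≡ μ z
      outside′ z z∉R′ = trans (≔-there _ x _ z≢x) (trans (≔-there F.ν x″ _ z≢x″) (F.outside z z∉R))
        where
        z∉R : R z ≢ true
        z∉R Rz = z∉R′ (decToBool-complete _ (inj₁ Rz))
        z≢x″ : z ≢ x″
        z≢x″ z≡x″ = z∉R′ (decToBool-complete _ (inj₂ z≡x″))
        z≢x : z ≢ x
        z≢x refl = z∉R Rx
      image′ : ∀ z w → ν′ z ≡ just w → ∃ λ z′ → μ z′ ≡ just w
      image′ z w e with ≔-just _ x (just y) e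
      ... | inj₁ (_ , refl) = x″ , μx″
      ... | inj₂ (_ , e′) with ≔-just F.ν x″ nothing e′
      ...   | inj₂ (_ , νz) = F.image z w νz

    finish : ∀ {R x y} → Freeing R x → E x y ≡ true → (∀ z → μ z ≢ just y) → Augmentation μ u
    finish {x = x} {y} F Exy y-free =
      ν′ , assign-valid F.valid Exy y-unused , covers u (inj₂ refl) , λ z matched → covers z (inj₁ matched)
      where
      module F = Freeing F
      ν′ : PartialMatching
      ν′ = F.ν [ x ≔ just y ]
      y-unused : ∀ z → F.ν z ≢ just y
      y-unused z νz = let z′ , μz′ = F.image z y νz in y-free z′ μz′
      covers : ∀ z → Matched μ z ⊎ z ≡ u → Matched ν′ z
      covers z c with z ≟F x
      ... | yes refl = y , ≔-here F.ν x _
      ... | no z≢x   = let w , νz = F.keeps z z≢x c in w , trans (≔-there F.ν x _ z≢x) νz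

    Covered : (Fin n → Bool) → Fin n → Set
    Covered R y = neighbours R y ≡ true → ∃ λ x → without u R x ≡ true × μ x ≡ just y

    -- By Hall's condition N(R) is larger than R ∖ u, so μ cannot reach all of it from R ∖ u.
    some-neighbour-uncovered : ∀ {R} → R u ≡ true → ∃ λ y → ¬ Covered R y
    some-neighbour-uncovered {R} Ru = ¬∀⟶∃¬ n (Covered R) covered? λ all-covered →
      <-irrefl refl (≤-<-trans (≤-trans (hall R) (N≤R⁻ all-covered)) R⁻<R)
      where
      covered? : ∀ y → Dec (Covered R y)
      covered? y = (neighbours R y ≟B true) →-dec
                   any? (λ x → (without u R x ≟B true) ×-dec ≡-dec _≟F_ (μ x) (just y))
      N≤R⁻ : (∀ y → Covered R y) → count (neighbours R) ≤ count (without u R)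
      N≤R⁻ all-covered = injection⇒count-≤ (neighbours R) (without u R) (λ y x → μ x ≡ just y)
        (λ y x → ≡-dec _≟F_ (μ x) (just y)) all-covered
        (λ y y′ x _ _ μx μx′ → just-injective (trans (sym μx) μx′))
      R⁻<R : count (without u R) < count R
      R⁻<R = count-< (λ z → proj₁ ∘ decToBool-sound _) u
                     (decToBool-reject _ λ (_ , u≢u) → u≢u refl) Ru

    explore-step : ∀ {R} → Explored R →
                   Augmentation μ u ⊎ ∃ λ x″ → R x″ ≢ true × Explored (insert x″ R)
    explore-step {R} (Ru , freeing) with some-neighbour-uncovered {R} Ru
    ... | y , uncovered with neighbours R y in Ny
    ...   | false = contradiction (λ ()) uncovered
    ...   | true with neighbours-sound {R} Ny | any? (λ z → ≡-dec _≟F_ (μ z) (just y))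
    ...     | x , Rx , Exy | no unmatched = inj₁ (finish (freeing x Rx) Exy λ z μz → unmatched (z , μz))
    ...     | x , Rx , Exy | yes (x″ , μx″) = inj₂ (x″ , x″∉R , decToBool-complete _ (inj₁ Ru) , freeing′)
      where
      x″≢u : x″ ≢ u
      x″≢u refl with () ← trans (sym u-free) μx″
      x″∉R : R x″ ≢ true
      x″∉R Rx″ = uncovered λ _ → x″ , decToBool-complete _ (Rx″ , x″≢u) , μx″
      freeing′ : ∀ z → insert x″ R z ≡ true → Freeing (insert x″ R) z
      freeing′ z z∈R′ with decToBool-sound _ z∈R′
      ... | inj₁ Rz   = freeing-mono (λ w Rw → decToBool-complete _ (inj₁ Rw)) (freeing z Rz)
      ... | inj₂ refl = alternate {R} Rx (freeing x Rx) Exy μx″ x″∉R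

    explore : ∀ k {R} → Explored R → n ≤ count R + k → Augmentation μ u
    explore k {R} explored bound with explore-step explored
    ... | inj₁ augmented = augmented
    ... | inj₂ (x″ , x″∉R , explored′) with k
    ...   | zero  = contradiction (count-full R (≤-antisym (count-≤ R) (subst (n ≤_) (+-identityʳ _) bound)) x″)
                                  x″∉R
    ...   | suc k = explore k explored′ (≤-trans bound (≤-trans (≤-reflexive (+-suc _ k)) (+-monoˡ-≤ k grows)))
      where
      grows : count R < count (insert x″ R)
      grows = count-< (λ z Rz → decToBool-complete _ (inj₁ Rz)) x″
                      (¬-not x″∉R) (decToBool-complete _ (inj₂ refl))

    augment : Augmentation μ u
    augment = explore n explored-start (m≤n+m n _)

  match-vertex : HallCondition → ∀ ν → IsValid ν → ∀ u → Augmentation ν u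
  match-vertex hall ν valid u with ν u in νu
  ... | just y  = ν , valid , (y , νu) , λ _ matched → matched
  ... | nothing = AlternatingPaths.augment hall ν valid u νu

  covering : HallCondition → ∀ k → k ≤ n →
             Σ PartialMatching λ ν → IsValid ν × (∀ x → toℕ x < k → Matched ν x)
  covering hall zero    _   = const nothing , ((λ _ _ ()) , (λ _ _ _ ())) , λ _ ()
  covering hall (suc k) k<n =
    let ν  , valid  , covered              = covering hall k (<⇒≤ k<n)
        ν′ , valid′ , new-matched , keeps = match-vertex hall ν valid (fromℕ< k<n)
        covers : ∀ x → toℕ x < k ⊎ toℕ x ≡ k → Matched ν′ x
        covers x = [ keeps x ∘ covered x
                   , (λ x≡k → subst (Matched ν′) (toℕ-injective (trans (toℕ-fromℕ< k<n) (sym x≡k)))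
                                    new-matched) ]′
    in ν′ , valid′ , λ x → covers x ∘ m<1+n⇒m<n∨m≡n

  hall⇒perfectMatching : HallCondition → PerfectMatching n E
  hall⇒perfectMatching hall with covering hall n ≤-refl
  ... | ν , (edges , injective) , covered = partner , partner-edge , partner-injective ,
                                            injective⇒surjective partner partner-injective
    where
    matched : ∀ x → Matched ν x
    matched x = covered x (toℕ<n x)
    partner : Fin n → Fin n
    partner = proj₁ ∘ matched
    partner-edge : ∀ x → E x (partner x) ≡ true
    partner-edge x = edges x (partner x) (proj₂ (matched x))
    partner-injective : ∀ x x′ → partner x ≡ partner x′ → x ≡ x′
    partner-injective x x′ eq =
      injective x x′ (partner x) (proj₂ (matched x)) (trans (proj₂ (matched x′)) (cong just (sym eq)))

module Reduction (n : ℕ) (E : Fin n → Fin n → Bool) (order : Fin n → Fin n)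
                 (dummyRank : Fin n → Fin (n ∸ 3) → Fin n)
                 (order-injective : ∀ a b → order a ≡ order b → a ≡ b)
                 (order-surjective : ∀ k → ∃ λ y → order y ≡ k) where

  m : ℕ
  m = n ∸ 3

  G : Instance
  G = instanceG n E order dummyRank

  data Side : Fin (n + m) → Set where
    real  : ∀ x → Side (x ↑ˡ m)
    dummy : ∀ j → Side (n ↑ʳ j)

  side : ∀ a → Side a
  side a with splitAt n a in eq
  ... | inj₁ x = subst Side (splitAt⁻¹-↑ˡ eq) (real x)
  ... | inj₂ j = subst Side (splitAt⁻¹-↑ʳ eq) (dummy j)

  real≢dummy : ∀ x j → x ↑ˡ m ≢ n ↑ʳ j
  real≢dummy x j eq with () ← trans (sym (splitAt-↑ˡ n x m)) (trans (cong (splitAt n) eq) (splitAt-↑ʳ n m j))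

  dummy⇒1≤n : Fin m → 1 ≤ n
  dummy⇒1≤n = go n
    where
    go : ∀ k → Fin (k ∸ 3) → 1 ≤ k
    go (suc k) _ = s≤s z≤n

  rank-edge : ∀ {x y} → E x y ≡ true → rank G (x ↑ˡ m) (y ↑ˡ m) ≡ just (suc (toℕ (order y)))
  rank-edge {x} {y} Exy rewrite splitAt-↑ˡ n x m | splitAt-↑ˡ n y m | Exy = refl

  rank-non-edge : ∀ {x y} → E x y ≡ false → rank G (x ↑ˡ m) (y ↑ˡ m) ≡ nothing
  rank-non-edge {x} {y} ¬Exy rewrite splitAt-↑ˡ n x m | splitAt-↑ˡ n y m | ¬Exy = refl

  rank-edge⁻ : ∀ {x y} → rank G (x ↑ˡ m) (y ↑ˡ m) ≢ nothing → E x y ≡ true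
  rank-edge⁻ {x} {y} ranked with E x y in Exy
  ... | true  = refl
  ... | false = contradiction (rank-non-edge Exy) ranked

  rank-dummy-real : ∀ j y → rank G (n ↑ʳ j) (y ↑ˡ m) ≡ nothing
  rank-dummy-real j y rewrite splitAt-↑ʳ n m j | splitAt-↑ˡ n y m = refl

  rank-own-dummy : ∀ j → rank G (n ↑ʳ j) (n ↑ʳ j) ≡ just 1
  rank-own-dummy j rewrite splitAt-↑ʳ n m j | decToBool-complete (j ≟F j) refl = refl

  rank-dummy-dummy⁻ : ∀ {i j} → rank G (n ↑ʳ i) (n ↑ʳ j) ≢ nothing → i ≡ j
  rank-dummy-dummy⁻ {i} {j} rewrite splitAt-↑ʳ n m i | splitAt-↑ʳ n m j with i ≟F j
  ... | yes i≡j = λ _ → i≡j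
  ... | no  _   = λ ranked → contradiction refl ranked

  rank-realPost : ∀ a y {i} → rank G a (y ↑ˡ m) ≡ just i → suc (toℕ (order y)) ≡ i
  rank-realPost a y ranked with side a
  ... | dummy j with () ← trans (sym (rank-dummy-real j y)) ranked
  ... | real x with E x y in Exy
  ...   | true  = just-injective (trans (sym (rank-edge Exy)) ranked)
  ...   | false with () ← trans (sym (rank-non-edge Exy)) ranked

  Assignment : Set
  Assignment = Fin (n + m) → Maybe (Fin (n + m))

  matchedRank-just : ∀ {M : Assignment} {a p} → M a ≡ just p → matchedRank G M a ≡ rank G a p
  matchedRank-just Ma rewrite Ma = refl

  matchedRank-just⁻ : ∀ {M : Assignment} {a i} → matchedRank G M a ≡ just i →
                      ∃ λ p → M a ≡ just p × rank G a p ≡ just i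
  matchedRank-just⁻ {M} {a} ranked with M a in Ma
  ... | just p = p , refl , ranked

  rankedAt : Assignment → ℕ → Fin (n + m) → Bool
  rankedAt M i a = decToBool (≡-dec _≟_ (matchedRank G M a) (just i))

  relabel : (Fin n → Fin n) → Fin (n + m) → Fin (n + m)
  relabel μ a with splitAt n a
  ... | inj₁ x = μ x ↑ˡ m
  ... | inj₂ j = n ↑ʳ j

  relabel-real : ∀ μ x → relabel μ (x ↑ˡ m) ≡ μ x ↑ˡ m
  relabel-real μ x rewrite splitAt-↑ˡ n x m = refl

  relabel-dummy : ∀ μ j → relabel μ (n ↑ʳ j) ≡ n ↑ʳ j
  relabel-dummy μ j rewrite splitAt-↑ʳ n m j = refl

  relabel-injective : ∀ {μ} → (∀ x x′ → μ x ≡ μ x′ → x ≡ x′) →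
                      ∀ a a′ → relabel μ a ≡ relabel μ a′ → a ≡ a′
  relabel-injective {μ} μ-injective a a′ same with side a | side a′
  ... | real x  | real x′  = cong (_↑ˡ m) (μ-injective x x′ (↑ˡ-injective m _ _
                               (trans (sym (relabel-real μ x)) (trans same (relabel-real μ x′)))))
  ... | real x  | dummy j′ = contradiction (trans (sym (relabel-real μ x)) (trans same (relabel-dummy μ j′)))
                                           (real≢dummy (μ x) j′)
  ... | dummy j | real x′  = contradiction (trans (sym (relabel-real μ x′)) (trans (sym same) (relabel-dummy μ j)))
                                           (real≢dummy (μ x′) j)
  ... | dummy j | dummy j′ = trans (sym (relabel-dummy μ j)) (trans same (relabel-dummy μ j′))

  lift : (Fin n → Fin n) → Assignment
  lift μ = just ∘ relabel μ

  lift-unique : ∀ μ (M : Assignment) →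
                (∀ x → M (x ↑ˡ m) ≡ just (μ x ↑ˡ m)) → (∀ j → M (n ↑ʳ j) ≡ just (n ↑ʳ j)) →
                ∀ a → lift μ a ≡ M a
  lift-unique μ M M-real M-dummy a with side a
  ... | real x  = trans (cong just (relabel-real μ x)) (sym (M-real x))
  ... | dummy j = trans (cong just (relabel-dummy μ j)) (sym (M-dummy j))

  module Lifted (pm : PerfectMatching n E) where

    μ : Fin n → Fin n
    μ = proj₁ pm

    edge : ∀ x → E x (μ x) ≡ true
    edge = proj₁ (proj₂ pm)

    μ-injective : ∀ x x′ → μ x ≡ μ x′ → x ≡ x′
    μ-injective = proj₁ (proj₂ (proj₂ pm))

    μ-surjective : ∀ y → ∃ λ x → μ x ≡ y
    μ-surjective = proj₂ (proj₂ (proj₂ pm))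

    rank-real : ∀ x → matchedRank G (lift μ) (x ↑ˡ m) ≡ just (suc (toℕ (order (μ x))))
    rank-real x = trans (matchedRank-just {lift μ} (cong just (relabel-real μ x))) (rank-edge (edge x))

    rank-dummy : ∀ j → matchedRank G (lift μ) (n ↑ʳ j) ≡ just 1
    rank-dummy j = trans (matchedRank-just {lift μ} (cong just (relabel-dummy μ j))) (rank-own-dummy j)

    isMatching : IsMatching G (lift μ)
    isMatching = edges , injective
      where
      ranked : ∀ a → matchedRank G (lift μ) a ≢ nothing
      ranked a with side a
      ... | real x  = λ r → contradiction (trans (sym (rank-real x)) r) λ ()
      ... | dummy j = λ r → contradiction (trans (sym (rank-dummy j)) r) λ ()
      edges : ∀ a p → lift μ a ≡ just p → rank G a p ≢ nothing
      edges a p e = ranked a ∘ trans (matchedRank-just {lift μ} e)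
      injective : ∀ a a′ p → lift μ a ≡ just p → lift μ a′ ≡ just p → a ≡ a′
      injective a a′ p e e′ = relabel-injective μ-injective a a′ (just-injective (trans e (sym e′)))

    matching : Matching G
    matching = lift μ , isMatching

    ranked-real : ∀ {i x} → rankedAt (lift μ) i (x ↑ˡ m) ≡ true → suc (toℕ (order (μ x))) ≡ i
    ranked-real {x = x} r = just-injective (trans (sym (rank-real x)) (decToBool-sound _ r))

    reals-ranked-once : ∀ i → suc i ≤ n → count (λ x → rankedAt (lift μ) (suc i) (x ↑ˡ m)) ≡ 1
    reals-ranked-once i i<n = count≡1 _ x (decToBool-complete _ (trans (rank-real x) (cong just hit))) unique
      where
      y = proj₁ (order-surjective (fromℕ< i<n))
      x = proj₁ (μ-surjective y)
      hit : suc (toℕ (order (μ x))) ≡ suc i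
      hit = trans (cong (suc ∘ toℕ) (trans (cong order (proj₂ (μ-surjective y)))
                                           (proj₂ (order-surjective (fromℕ< i<n)))))
                  (cong suc (toℕ-fromℕ< i<n))
      unique : ∀ x x′ → rankedAt (lift μ) (suc i) (x ↑ˡ m) ≡ true →
               rankedAt (lift μ) (suc i) (x′ ↑ˡ m) ≡ true → x ≡ x′
      unique x x′ r r′ = μ-injective x x′ (order-injective _ _ (toℕ-injective (suc-injective
                           (trans (ranked-real r) (sym (ranked-real r′))))))

    dummies-ranked-1 : count (λ j → rankedAt (lift μ) 1 (n ↑ʳ j)) ≡ m
    dummies-ranked-1 = count-all _ λ j → decToBool-complete _ (rank-dummy j)

    dummies-unranked : ∀ {i} → i ≢ 1 → count (λ j → rankedAt (lift μ) i (n ↑ʳ j)) ≡ 0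
    dummies-unranked i≢1 = count-zero _ λ j →
      decToBool-reject _ λ r → i≢1 (just-injective (trans (sym r) (rank-dummy j)))

    signature-1 : 1 ≤ n → signature G matching 1 ≡ 1 + m
    signature-1 1≤n = trans (count-split {n} _) (cong₂ _+_ (reals-ranked-once 0 1≤n) dummies-ranked-1)

    signature-2+ : ∀ i → 2 + i ≤ n → signature G matching (2 + i) ≡ 1
    signature-2+ i i<n = trans (count-split {n} _) (cong₂ _+_ (reals-ranked-once (suc i) i<n) (dummies-unranked λ ()))

  taken? : ∀ (M : Assignment) i p → Dec (∃ λ a → M a ≡ just p × rank G a p ≡ just i)
  taken? M i p = any? λ a → ≡-dec _≟F_ (M a) (just p) ×-dec ≡-dec _≟_ (rank G a p) (just i)

  takenAt : Assignment → ℕ → Fin (n + m) → Bool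
  takenAt M i p = decToBool (taken? M i p)

  realsTaken dummiesTaken : Assignment → ℕ → ℕ
  realsTaken   M i = count (λ y → takenAt M i (y ↑ˡ m))
  dummiesTaken M i = count (λ j → takenAt M i (n ↑ʳ j))

  signature≤taken : ∀ (M : Matching G) i → signature G M i ≤ realsTaken (proj₁ M) i + dummiesTaken (proj₁ M) i
  signature≤taken (M , _ , injective) i = ≤-trans
    (injection⇒count-≤ (rankedAt M i) (takenAt M i) (λ a p → M a ≡ just p)
                       (λ a p → ≡-dec _≟F_ (M a) (just p)) total (λ a a′ p _ _ → injective a a′ p))
    (≤-reflexive (count-split {n} (takenAt M i)))
    where
    total : ∀ a → rankedAt M i a ≡ true → ∃ λ p → takenAt M i p ≡ true × M a ≡ just p
    total a r = let p , Ma , ranked = matchedRank-just⁻ {M} (decToBool-sound _ r)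
                in p , decToBool-complete (taken? M i p) (a , Ma , ranked) , Ma

  realsTaken≤1 : ∀ M i → realsTaken M i ≤ 1
  realsTaken≤1 M i = count≤1 _ λ y y′ t t′ →
    let a  , _ , r  = decToBool-sound (taken? M i _) t
        a′ , _ , r′ = decToBool-sound (taken? M i _) t′
    in order-injective y y′ (toℕ-injective (suc-injective (trans (rank-realPost a y r) (sym (rank-realPost a′ y′ r′)))))

  Saturated : Matching G → Set
  Saturated M = signature G M 1 ≡ 1 + m

  signature-1≤ : ∀ M → signature G M 1 ≤ 1 + m
  signature-1≤ M = ≤-trans (signature≤taken M 1) (+-mono-≤ (realsTaken≤1 _ 1) (count-≤ _))

  saturated⇒dummiesTaken : ∀ M → Saturated M → ∀ j → takenAt (proj₁ M) 1 (n ↑ʳ j) ≡ true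
  saturated⇒dummiesTaken M saturated = count-full _ (≤-antisym (count-≤ _) (+-cancelˡ-≤ 1 _ _ (begin
    1 + m                                             ≡⟨ saturated ⟨
    signature G M 1                                   ≤⟨ signature≤taken M 1 ⟩
    realsTaken (proj₁ M) 1 + dummiesTaken (proj₁ M) 1 ≤⟨ +-monoˡ-≤ _ (realsTaken≤1 _ 1) ⟩
    1 + dummiesTaken (proj₁ M) 1                      ∎)))
    where open ≤-Reasoning

  saturated⇒dummiesUntaken : ∀ M → Saturated M → ∀ {i} → i ≢ 1 → dummiesTaken (proj₁ M) i ≡ 0
  saturated⇒dummiesUntaken M saturated {i} i≢1 = count-zero _ λ j → ¬-not λ t →
    let a  , Ma  , r  = decToBool-sound (taken? (proj₁ M) i _) t
        a′ , Ma′ , r′ = decToBool-sound (taken? (proj₁ M) 1 _) (saturated⇒dummiesTaken M saturated j)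
        a′≡a = proj₂ (proj₂ M) a′ a _ Ma′ Ma
    in i≢1 (just-injective (trans (sym r) (subst (λ b → rank G b _ ≡ just 1) a′≡a r′)))

  saturated⇒signature≤1 : ∀ M → Saturated M → ∀ {i} → i ≢ 1 → signature G M i ≤ 1
  saturated⇒signature≤1 M saturated {i} i≢1 = begin
    signature G M i                                   ≤⟨ signature≤taken M i ⟩
    realsTaken (proj₁ M) i + dummiesTaken (proj₁ M) i ≡⟨ cong (realsTaken (proj₁ M) i +_)
                                                             (saturated⇒dummiesUntaken M saturated i≢1) ⟩
    realsTaken (proj₁ M) i + 0                        ≡⟨ +-identityʳ _ ⟩
    realsTaken (proj₁ M) i                            ≤⟨ realsTaken≤1 _ i ⟩
    1                                                 ∎
    where open ≤-Reasoning

  lift-dominates : ∀ pm M → Dominates n (signature G (Lifted.matching pm)) (signature G M)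
  lift-dominates pm M (suc zero)    _ 1≤n _     =
    subst (signature G M 1 ≤_) (sym (Lifted.signature-1 pm 1≤n)) (signature-1≤ M)
  lift-dominates pm M (suc (suc i)) _ i<n agree = subst (signature G M (2 + i) ≤_) (sym (Lifted.signature-2+ pm i i<n))
    (saturated⇒signature≤1 M saturated λ ())
    where
    saturated : Saturated M
    saturated = trans (agree 1 ≤-refl (s≤s (s≤s z≤n))) (Lifted.signature-1 pm (≤-trans (s≤s z≤n) i<n))

  toRankMaximal : PerfectMatching n E → RankMaximalMatching G
  toRankMaximal pm = Lifted.matching pm , λ M → dominates⇒¬lexGreater (lift-dominates pm M)

  module FromRankMaximal (pm₀ : PerfectMatching n E) (RM : RankMaximalMatching G) where

    matching : Matching G
    matching = proj₁ RM

    M : Assignment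
    M = proj₁ matching

    agrees : ∀ i → 1 ≤ i → i ≤ n → signature G matching i ≡ signature G (Lifted.matching pm₀) i
    agrees = dominates⇒agree (lift-dominates pm₀ matching) (proj₂ RM (Lifted.matching pm₀))

    saturated : 1 ≤ n → Saturated matching
    saturated 1≤n = trans (agrees 1 ≤-refl 1≤n) (Lifted.signature-1 pm₀ 1≤n)

    dummies<signature : ∀ i → 1 ≤ i → i ≤ n → dummiesTaken M i < signature G matching i
    dummies<signature (suc zero)    _ 1≤n = subst (dummiesTaken M 1 <_) (sym (saturated 1≤n)) (s≤s (count-≤ _))
    dummies<signature (suc (suc i)) _ i<n = subst₂ _<_
      (sym (saturated⇒dummiesUntaken matching (saturated (≤-trans (s≤s z≤n) i<n)) λ ()))
      (sym (trans (agrees (2 + i) (s≤s z≤n) i<n) (Lifted.signature-2+ pm₀ i i<n)))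
      (s≤s z≤n)

    realsTaken-pos : ∀ i → 1 ≤ i → i ≤ n → 0 < realsTaken M i
    realsTaken-pos i 1≤i i≤n =
      +-cancelʳ-< (dummiesTaken M i) 0 _ (<-≤-trans (dummies<signature i 1≤i i≤n) (signature≤taken matching i))

    owner : ∀ y → ∃ λ x → M (x ↑ˡ m) ≡ just (y ↑ˡ m)
    owner y with count-pos _ (realsTaken-pos (suc (toℕ (order y))) (s≤s z≤n) (toℕ<n (order y)))
    ... | y′ , taken with decToBool-sound (taken? M _ _) taken
    ... | a , Ma , ranked with order-injective y′ y (toℕ-injective (suc-injective (rank-realPost a y′ ranked)))
    ... | refl with side a
    ...   | real x  = x , Ma
    ...   | dummy j with () ← trans (sym (rank-dummy-real j y′)) ranked

    owner-injective : ∀ y y′ → proj₁ (owner y) ≡ proj₁ (owner y′) → y ≡ y′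
    owner-injective y y′ eq = ↑ˡ-injective m y y′ (just-injective
      (trans (sym (proj₂ (owner y))) (trans (cong (λ x → M (x ↑ˡ m)) eq) (proj₂ (owner y′)))))

    real-partner : ∀ x → ∃ λ y → M (x ↑ˡ m) ≡ just (y ↑ˡ m)
    real-partner x = let y , owns = injective⇒surjective (proj₁ ∘ owner) owner-injective x
                     in y , subst (λ z → M (z ↑ˡ m) ≡ just (y ↑ˡ m)) owns (proj₂ (owner y))

    partner : Fin n → Fin n
    partner = proj₁ ∘ real-partner

    M-real : ∀ x → M (x ↑ˡ m) ≡ just (partner x ↑ˡ m)
    M-real = proj₂ ∘ real-partner

    perfectMatching : PerfectMatching n E
    perfectMatching = partner , edge , partner-injective , partner-surjective
      where
      edge : ∀ x → E x (partner x) ≡ true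
      edge x = rank-edge⁻ (proj₁ (proj₂ matching) _ _ (M-real x))
      partner-injective : ∀ x x′ → partner x ≡ partner x′ → x ≡ x′
      partner-injective x x′ eq = ↑ˡ-injective m x x′ (proj₂ (proj₂ matching) _ _ _ (M-real x)
        (trans (M-real x′) (cong (λ y → just (y ↑ˡ m)) (sym eq))))
      partner-surjective : ∀ y → ∃ λ x → partner x ≡ y
      partner-surjective y = proj₁ (owner y) ,
        ↑ˡ-injective m _ y (just-injective (trans (sym (M-real _)) (proj₂ (owner y))))

    M-dummy : ∀ j → M (n ↑ʳ j) ≡ just (n ↑ʳ j)
    M-dummy j with decToBool-sound (taken? M 1 _) (saturated⇒dummiesTaken matching (saturated (dummy⇒1≤n j)) j)
    ... | a , Ma , ranked with side a
    ...   | real x  = contradiction (just-injective (trans (sym (M-real x)) Ma)) (real≢dummy (partner x) j)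
    ...   | dummy i with rank-dummy-dummy⁻ {i} {j} (λ unranked → contradiction (trans (sym unranked) ranked) λ ())
    ...     | refl = Ma

    lift-partner : ∀ a → lift partner a ≡ M a
    lift-partner = lift-unique partner M M-real M-dummy

  fromRankMaximal : PerfectMatching n E → RankMaximalMatching G → PerfectMatching n E
  fromRankMaximal = FromRankMaximal.perfectMatching

  from∘to : ∀ pm₀ pm x → proj₁ (fromRankMaximal pm₀ (toRankMaximal pm)) x ≡ proj₁ pm x
  from∘to pm₀ pm x = ↑ˡ-injective m _ _ (just-injective
    (trans (sym (FromRankMaximal.M-real pm₀ (toRankMaximal pm) x)) (cong just (relabel-real (proj₁ pm) x))))

  to∘from : ∀ pm₀ RM a → proj₁ (proj₁ (toRankMaximal (fromRankMaximal pm₀ RM))) a ≡ proj₁ (proj₁ RM) a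
  to∘from = FromRankMaximal.lift-partner

lemma5 : (n : ℕ) (E : Fin n → Fin n → Bool) → ThreeRegular n E →
         (order : Fin n → Fin n) → IsBijection order →
         (dummyRank : Fin n → Fin (n ∸ 3) → Fin n) → ValidFilling n E order dummyRank →
         Σ (PerfectMatching n E → RankMaximalMatching (instanceG n E order dummyRank)) λ f →
         Σ (RankMaximalMatching (instanceG n E order dummyRank) → PerfectMatching n E) λ g →
           (∀ μ x → proj₁ (g (f μ)) x ≡ proj₁ μ x) ×
           (∀ M a → proj₁ (proj₁ (f (g M))) a ≡ proj₁ (proj₁ M) a)
lemma5 n E (degX , degY) order (order-injective , order-surjective) dummyRank _ =
  toRankMaximal , fromRankMaximal pm₀ , from∘to pm₀ , to∘from pm₀
  where
  open Reduction n E order dummyRank order-injective order-surjective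
  pm₀ : PerfectMatching n E
  pm₀ = Hall.hall⇒perfectMatching n E (Hall.regular⇒hall n E 3 degX degY)
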